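{- Let $\mathbf{t}$ be the Tribonacci word. If $k\ge2$ and $n\le\frac{T_{k+1}+T_{k-1}-3}{2}$, then $\operatorname{nsc}_{\mathbf{t}}(n)\le T_k$.
   Context: The Tribonacci word is $\mathbf{t}=\sigma^{\omega}(0)$, the fixed point of $\sigma(0)=01$, $\sigma(1)=02$, $\sigma(2)=0$. Tribonacci numbers: $T_{ -1}=1$, $T_0=1$, $T_1=2$, $T_2=4$, $T_k=T_{k-1}+T_{k-2}+T_{k-3}$ for $k\ge3$. For an infinite word $\mathbf{x}=x_0x_1x_2\cdots$ (indexed from $0$) and $n\ge1$, $\operatorname{nsc}_{\mathbf{x}}(n)=\max\{m\in\mathbb{N}: x_i\cdots x_{i+n-1}\neq x_j\cdots x_{j+n-1}\text{ for all } 0\le i<j\le m-1\}$. -}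

module Defs where

open import Data.Nat using (ℕ; zero; suc; _+_; _*_; _∸_; _≤_; _<_)
open import Data.Fin using (Fin; zero; suc; toℕ)
open import Data.List using (List; []; _∷_; _++_; concatMap; length)
open import Data.Vec using (Vec; tabulate)
open import Relation.Binary.PropositionalEquality using (_≡_; _≢_)
open import Data.Product using (_×_)

-- Tribonacci numbers, shifted: Tr m = T_{m-1}, so T_{-1} = Tr 0.
Tr : ℕ → ℕ
Tr 0 = 1
Tr 1 = 1
Tr 2 = 2
Tr 3 = 4
Tr (suc (suc (suc (suc m)))) =
  Tr (suc (suc (suc m))) + Tr (suc (suc m)) + Tr (suc m)

T : ℕ → ℕ
T k = Tr (suc k)

σ : Fin 3 → List (Fin 3)
σ zero = zero ∷ suc zero ∷ []
σ (suc zero) = zero ∷ suc (suc zero) ∷ []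
σ (suc (suc zero)) = zero ∷ []

σ* : List (Fin 3) → List (Fin 3)
σ* = concatMap σ

σ^ : ℕ → List (Fin 3)
σ^ zero = zero ∷ []
σ^ (suc k) = σ* (σ^ k)

-- i-th letter of a list, defaulting to 0 out of range
at : List (Fin 3) → ℕ → Fin 3
at [] _ = zero
at (a ∷ _) zero = a
at (_ ∷ w) (suc i) = at w i

-- The Tribonacci word t = σ^ω(0), indexed from 0.  Since each σ^k(0) is a
-- prefix of σ^{k+1}(0) and |σ^k(0)| = T_k ≥ k + 1, the letter t_i is the
-- i-th letter of σ^{i+1}(0) (well within range).
t : ℕ → Fin 3
t i = at (σ^ (suc i)) i

factor : (ℕ → Fin 3) → (n : ℕ) → ℕ → Vec (Fin 3) n
factor x n i = tabulate (λ l → x (i + toℕ l))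

DistinctPrefixFactors : (ℕ → Fin 3) → ℕ → ℕ → Set
DistinctPrefixFactors x n m =
  ∀ i j → i < j → j < m → factor x n i ≢ factor x n j

IsNsc : (ℕ → Fin 3) → ℕ → ℕ → Set
IsNsc x n m = DistinctPrefixFactors x n m × (∀ m' → DistinctPrefixFactors x n m' → m' ≤ m)

module Submission where

-- The prefix of the Tribonacci word t of length T_k + L k has period T_k,
-- where L k = (T_{k+1} + T_{k-1} - 3)/2.  Hence, for n ≤ L k, the factors of
-- length n at positions 0 and T_k coincide, so no window of T_k + 1 starting
-- positions can carry pairwise distinct factors: nsc_t(n) ≤ T_k.

open import Defs
open import Data.Nat using (ℕ; zero; suc; _+_; _*_; _∸_; _≤_; _<_; z≤n; s≤s; _<?_; _≤?_)
open import Data.Nat.Properties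
open import Data.Nat.Tactic.RingSolver using (solve-∀)
open import Data.Fin as Fin using (Fin; toℕ)
open import Data.Fin.Properties using (toℕ<n)
open import Data.List using (List; []; _∷_; _++_; length)
open import Data.List.Properties using (length-++; concatMap-++; ++-assoc; ++-identityʳ)
open import Data.Vec.Properties using (tabulate-cong)
open import Data.Product using (∃; _,_)
open import Data.Sum using (_⊎_; inj₁; inj₂)
open import Relation.Binary.PropositionalEquality
open import Relation.Nullary using (yes; no)
open import Data.Empty using (⊥-elim)

at-++ˡ : ∀ (u v : List (Fin 3)) i → i < length u → at (u ++ v) i ≡ at u i
at-++ˡ (x ∷ u) v zero    _         = refl
at-++ˡ (x ∷ u) v (suc i) (s≤s i<u) = at-++ˡ u v i i<u

at-++ʳ : ∀ (u v : List (Fin 3)) i → at (u ++ v) (length u + i) ≡ at v i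
at-++ʳ []      v i = refl
at-++ʳ (x ∷ u) v i = at-++ʳ u v i

split-at : ∀ p l → l < p ⊎ ∃ λ r → l ≡ p + r
split-at p l with l <? p
... | yes l<p = inj₁ l<p
... | no  l≮p with m≤n⇒∃[o]m+o≡n (≮⇒≥ l≮p)
...   | r , p+r≡l = inj₂ (r , sym p+r≡l)

σ^-rec : ∀ a → σ^ (3 + a) ≡ σ^ (2 + a) ++ (σ^ (1 + a) ++ σ^ a)
σ^-rec zero    = refl
σ^-rec (suc a) = begin
  σ* (σ^ (3 + a))                                 ≡⟨ cong σ* (σ^-rec a) ⟩
  σ* (σ^ (2 + a) ++ (σ^ (1 + a) ++ σ^ a))         ≡⟨ concatMap-++ σ (σ^ (2 + a)) _ ⟩
  σ^ (3 + a) ++ σ* (σ^ (1 + a) ++ σ^ a)           ≡⟨ cong (σ^ (3 + a) ++_) (concatMap-++ σ (σ^ (1 + a)) _) ⟩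
  σ^ (3 + a) ++ (σ^ (2 + a) ++ σ^ (1 + a))        ∎
  where open ≡-Reasoning

length-σ^ : ∀ a → length (σ^ a) ≡ T a
length-σ^ 0 = refl
length-σ^ 1 = refl
length-σ^ 2 = refl
length-σ^ (suc (suc (suc a))) = begin
  length (σ^ (3 + a))                                       ≡⟨ cong length (σ^-rec a) ⟩
  length (σ^ (2 + a) ++ (σ^ (1 + a) ++ σ^ a))               ≡⟨ length-++ (σ^ (2 + a)) ⟩
  length (σ^ (2 + a)) + length (σ^ (1 + a) ++ σ^ a)         ≡⟨ cong (length (σ^ (2 + a)) +_) (length-++ (σ^ (1 + a))) ⟩
  length (σ^ (2 + a)) + (length (σ^ (1 + a)) + length (σ^ a))
    ≡⟨ cong₂ _+_ (length-σ^ (suc (suc a))) (cong₂ _+_ (length-σ^ (suc a)) (length-σ^ a)) ⟩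
  T (2 + a) + (T (1 + a) + T a)                             ≡⟨ +-assoc (T (2 + a)) _ _ ⟨
  T (3 + a)                                                 ∎
  where open ≡-Reasoning

-- T grows at least linearly: a < T_a (so T_a > 0 and t_i lies within σ^{i+1}(0)).
n<T : ∀ a → a < T a
n<T 0 = s≤s z≤n
n<T 1 = s≤s (s≤s z≤n)
n<T 2 = s≤s (s≤s (s≤s z≤n))
n<T (suc (suc (suc a))) = begin-strict
  3 + a                    ≤⟨ n<T (suc (suc a)) ⟩
  T (2 + a)                <⟨ m<m+n (T (2 + a)) (≤-trans (s≤s z≤n) (n<T (suc a))) ⟩
  T (2 + a) + T (1 + a)    ≤⟨ m≤m+n _ (T a) ⟩
  T (3 + a)                ∎
  where open ≤-Reasoning

-- σ^a(0) is a prefix of σ^{a+1}(0): apply σ^a to 0 ⊑ 01.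
σ^-extends-once : ∀ a → ∃ λ w → σ^ (suc a) ≡ σ^ a ++ w
σ^-extends-once zero    = Fin.suc Fin.zero ∷ [] , refl
σ^-extends-once (suc a) with σ^-extends-once a
... | w , σ^1+a≡ = σ* w , trans (cong σ* σ^1+a≡) (concatMap-++ σ (σ^ a) w)

σ^-extends : ∀ a d → ∃ λ w → σ^ (d + a) ≡ σ^ a ++ w
σ^-extends a zero    = [] , sym (++-identityʳ (σ^ a))
σ^-extends a (suc d) with σ^-extends a d | σ^-extends-once (d + a)
... | w , σ^d+a≡ | w′ , σ^1+d+a≡ =
  w ++ w′ , trans σ^1+d+a≡ (trans (cong (_++ w′) σ^d+a≡) (++-assoc (σ^ a) w w′))

at-σ^-stable : ∀ a d i → i < T a → at (σ^ (d + a)) i ≡ at (σ^ a) i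
at-σ^-stable a d i i<T with σ^-extends a d
... | w , σ^d+a≡ rewrite σ^d+a≡ = at-++ˡ (σ^ a) w i (subst (i <_) (sym (length-σ^ a)) i<T)

t-reads-σ^ : ∀ a i → i < T a → t i ≡ at (σ^ a) i
t-reads-σ^ a i i<T = begin
  at (σ^ (suc i)) i      ≡⟨ at-σ^-stable (suc i) a i (≤-trans (n≤1+n (suc i)) (n<T (suc i))) ⟨
  at (σ^ (a + suc i)) i  ≡⟨ cong (λ b → at (σ^ b) i) (+-comm a (suc i)) ⟩
  at (σ^ (suc i + a)) i  ≡⟨ at-σ^-stable a (suc i) i i<T ⟩
  at (σ^ a) i            ∎
  where open ≡-Reasoning

t-reads-block : ∀ b u v i → σ^ b ≡ u ++ v → i < length v → t (length u + i) ≡ at v i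
t-reads-block b u v i σ^b≡uv i<v = begin
  t (length u + i)           ≡⟨ t-reads-σ^ b (length u + i) bound ⟩
  at (σ^ b) (length u + i)   ≡⟨ cong (λ w → at w (length u + i)) σ^b≡uv ⟩
  at (u ++ v) (length u + i) ≡⟨ at-++ʳ u v i ⟩
  at v i                     ∎
  where
  open ≡-Reasoning
  bound : length u + i < T b
  bound = subst (length u + i <_) (trans (sym (length-++ u)) (trans (cong length (sym σ^b≡uv)) (length-σ^ b)))
                (+-monoʳ-< (length u) i<v)

length-pair : ∀ a → length (σ^ (2 + a) ++ σ^ (1 + a)) ≡ T (2 + a) + T (1 + a)
length-pair a = trans (length-++ (σ^ (2 + a))) (cong₂ _+_ (length-σ^ (2 + a)) (length-σ^ (1 + a)))

-- t has period T_{a+3} on its first T_{a+4} letters: both σ^{a+3}(0) and the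
-- block of σ^{a+4}(0) after σ^{a+3}(0) begin with σ^{a+2}(0) σ^{a+1}(0).
period-T : ∀ a l → l < T (2 + a) + T (1 + a) → t (T (3 + a) + l) ≡ t l
period-T a l l<p = begin
  t (T (3 + a) + l)               ≡⟨ cong (λ s → t (s + l)) (length-σ^ (3 + a)) ⟨
  t (length (σ^ (3 + a)) + l)     ≡⟨ t-reads-block (4 + a) (σ^ (3 + a)) pair l (σ^-rec (1 + a)) l<pair ⟩
  at pair l                       ≡⟨ at-++ˡ pair (σ^ a) l l<pair ⟨
  at (pair ++ σ^ a) l             ≡⟨ t-reads-block (3 + a) [] (pair ++ σ^ a) l σ^3+a≡ l<pair++ ⟨
  t l                             ∎
  where
  open ≡-Reasoning
  pair : List (Fin 3)
  pair = σ^ (2 + a) ++ σ^ (1 + a)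
  l<pair : l < length pair
  l<pair = subst (l <_) (sym (length-pair a)) l<p
  l<pair++ : l < length (pair ++ σ^ a)
  l<pair++ = ≤-trans l<pair (subst (length pair ≤_) (sym (length-++ pair)) (m≤m+n _ _))
  σ^3+a≡ : σ^ (3 + a) ≡ pair ++ σ^ a
  σ^3+a≡ = trans (σ^-rec a) (sym (++-assoc (σ^ (2 + a)) (σ^ (1 + a)) (σ^ a)))

-- After the block σ^{a+2}(0) σ^{a+1}(0), the word t continues with σ^a(0),
-- which is also a prefix of t.
after-pair : ∀ a r → r < T a → t (T (2 + a) + T (1 + a) + r) ≡ t r
after-pair a r r<T = begin
  t (T (2 + a) + T (1 + a) + r)                        ≡⟨ cong (λ s → t (s + r)) (length-pair a) ⟨
  t (length (σ^ (2 + a) ++ σ^ (1 + a)) + r)            ≡⟨ t-reads-block (3 + a) _ (σ^ a) r σ^3+a≡ r<σ^a ⟩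
  at (σ^ a) r                                          ≡⟨ t-reads-σ^ a r r<T ⟨
  t r                                                  ∎
  where
  open ≡-Reasoning
  σ^3+a≡ : σ^ (3 + a) ≡ (σ^ (2 + a) ++ σ^ (1 + a)) ++ σ^ a
  σ^3+a≡ = trans (σ^-rec a) (sym (++-assoc (σ^ (2 + a)) (σ^ (1 + a)) (σ^ a)))
  r<σ^a : r < length (σ^ a)
  r<σ^a = subst (r <_) (sym (length-σ^ a)) r<T

-- L k = (T_{k+1} + T_{k-1} - 3)/2, defined by its recursion L (k+3) = T_{k+3} + L k.
-- The prefix of t of length T_k + L k has period T_k.
L : ℕ → ℕ
L 0 = 0
L 1 = 1
L 2 = 3
L (suc (suc (suc a))) = T (3 + a) + L a

L≤T : ∀ a → L a ≤ T (1 + a)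
L≤T 0 = z≤n
L≤T 1 = s≤s z≤n
L≤T 2 = s≤s (s≤s (s≤s z≤n))
L≤T (suc (suc (suc a))) = begin
  T (3 + a) + L a                    ≤⟨ +-monoʳ-≤ (T (3 + a)) (L≤T a) ⟩
  T (3 + a) + T (1 + a)              ≤⟨ +-monoˡ-≤ (T (1 + a)) (m≤m+n (T (3 + a)) (T (2 + a))) ⟩
  T (3 + a) + T (2 + a) + T (1 + a)  ∎
  where open ≤-Reasoning

-- The window T_a + L a fits inside the range T_{a+3} + T_{a+2} of period-T at level a + 1.
T+L≤ : ∀ a → T a + L a ≤ T (3 + a) + T (2 + a)
T+L≤ a = begin
  T a + L a                      ≤⟨ +-monoʳ-≤ (T a) (L≤T a) ⟩
  T a + T (1 + a)                ≤⟨ m≤n+m _ (T (2 + a)) ⟩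
  T (2 + a) + (T a + T (1 + a))  ≡⟨ cong (T (2 + a) +_) (+-comm (T a) _) ⟩
  T (2 + a) + (T (1 + a) + T a)  ≡⟨ +-assoc (T (2 + a)) _ _ ⟨
  T (3 + a)                      ≤⟨ m≤m+n _ (T (2 + a)) ⟩
  T (3 + a) + T (2 + a)          ∎
  where open ≤-Reasoning

twice-L : ∀ a → 2 * L (suc a) + 3 ≡ T (2 + a) + T a
twice-L 0 = refl
twice-L 1 = refl
twice-L 2 = refl
twice-L (suc (suc (suc a))) = begin
  2 * (T (4 + a) + L (1 + a)) + 3    ≡⟨ distribute-2 (L (1 + a)) (T a) (T (1 + a)) (T (2 + a)) ⟩
  2 * T (4 + a) + (2 * L (1 + a) + 3) ≡⟨ cong (2 * T (4 + a) +_) (twice-L a) ⟩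
  2 * T (4 + a) + (T (2 + a) + T a)  ≡⟨ regroup-T (T a) (T (1 + a)) (T (2 + a)) ⟩
  T (5 + a) + T (3 + a)              ∎
  where
  open ≡-Reasoning
  -- written out in terms of x = T_a, y = T_{a+1}, z = T_{a+2}
  distribute-2 : ∀ l x y z → 2 * (((z + y + x) + z + y) + l) + 3 ≡ 2 * ((z + y + x) + z + y) + (2 * l + 3)
  distribute-2 = solve-∀
  regroup-T : ∀ x y z → 2 * ((z + y + x) + z + y) + (z + x) ≡ (((z + y + x) + z + y) + (z + y + x) + z) + (z + y + x)
  regroup-T = solve-∀

-- Shifting by p = T_{a+2} + T_{a+1} fixes the first T_a + L a letters, given
-- the periodicity at level a: for r = T_a + r', t_{p+r} = t_{T_{a+3}+r'} = t_{r'} = t_{T_a+r'}.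
shift-by-pair : ∀ a → (∀ r → r < L a → t (T a + r) ≡ t r) →
  ∀ r → r < T a + L a → t (T (2 + a) + T (1 + a) + r) ≡ t r
shift-by-pair a periodic-a r r<TL with split-at (T a) r
... | inj₁ r<T = after-pair a r r<T
... | inj₂ (r' , refl) = begin
  t (T (2 + a) + T (1 + a) + (T a + r'))   ≡⟨ cong t (+-assoc (T (2 + a) + T (1 + a)) (T a) r') ⟨
  t (T (3 + a) + r')                       ≡⟨ period-T a r' (≤-trans r'<L (≤-trans (L≤T a) (m≤n+m _ _))) ⟩
  t r'                                     ≡⟨ periodic-a r' r'<L ⟨
  t (T a + r')                             ∎
  where
  open ≡-Reasoning
  r'<L : r' < L a
  r'<L = +-cancelˡ-< (T a) r' (L a) r<TL

-- For level a + 3 split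
-- l < p + (T_a + L a) at p = T_{a+2} + T_{a+1}: below p this is period-T; for
-- l = p + r, t_{T_{a+3}+p+r} = t_{T_{a+4}+r} = t_r = t_{p+r} by period-T at
-- level a + 1 and shift-by-pair.
periodic : ∀ a l → l < L a → t (T a + l) ≡ t l
periodic 0 l ()
periodic 1 0 _ = refl
periodic 1 (suc l) (s≤s ())
periodic 2 0 _ = refl
periodic 2 1 _ = refl
periodic 2 2 _ = refl
periodic 2 (suc (suc (suc l))) (s≤s (s≤s (s≤s ())))
periodic (suc (suc (suc a))) l l<L with split-at (T (2 + a) + T (1 + a)) l
... | inj₁ l<p = period-T a l l<p
... | inj₂ (r , refl) = begin
  t (T (3 + a) + (T (2 + a) + T (1 + a) + r))  ≡⟨ cong t (+-assoc (T (3 + a)) _ r) ⟨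
  t (T (3 + a) + (T (2 + a) + T (1 + a)) + r)  ≡⟨ cong (λ s → t (s + r)) (+-assoc (T (3 + a)) _ _) ⟨
  t (T (4 + a) + r)                            ≡⟨ period-T (suc a) r (≤-trans r<TL (T+L≤ a)) ⟩
  t r                                          ≡⟨ shift-by-pair a (periodic a) r r<TL ⟨
  t (T (2 + a) + T (1 + a) + r)                ∎
  where
  open ≡-Reasoning
  r<TL : r < T a + L a
  r<TL = +-cancelˡ-< (T (2 + a) + T (1 + a)) r (T a + L a)
           (subst (T (2 + a) + T (1 + a) + r <_) (+-assoc (T (2 + a) + T (1 + a)) (T a) (L a)) l<L)

-- A word whose first q + n letters have period q > 0 repeats its length-n
-- factor at positions 0 and q, so at most q positions carry distinct factors.
nsc≤period : ∀ (x : ℕ → Fin 3) n m q → 0 < q →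
  (∀ l → l < n → x (q + l) ≡ x l) → DistinctPrefixFactors x n m → m ≤ q
nsc≤period x n m q 0<q period distinct with m ≤? q
... | yes m≤q = m≤q
... | no  m≰q = ⊥-elim (distinct 0 q 0<q (≰⇒> m≰q) same-factor)
  where
  same-factor : factor x n 0 ≡ factor x n q
  same-factor = tabulate-cong (λ l → sym (period (toℕ l) (toℕ<n l)))

n≤L : ∀ j n → 2 * n ≤ T (suc j + 1) + T j ∸ 3 → n ≤ L (suc j)
n≤L j n 2n≤ = *-cancelˡ-≤ 2 (subst (2 * n ≤_) bound≡2L 2n≤)
  where
  bound≡2L : T (suc j + 1) + T j ∸ 3 ≡ 2 * L (suc j)
  bound≡2L = begin
    T (suc j + 1) + T j ∸ 3       ≡⟨ cong (λ s → T (suc s) + T j ∸ 3) (+-comm j 1) ⟩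
    T (2 + j) + T j ∸ 3           ≡⟨ cong (_∸ 3) (twice-L j) ⟨
    2 * L (suc j) + 3 ∸ 3         ≡⟨ m+n∸n≡m (2 * L (suc j)) 3 ⟩
    2 * L (suc j)                 ∎
    where open ≡-Reasoning

mainTheorem11 : (k n m : ℕ) → 2 ≤ k → 1 ≤ n →
    2 * n ≤ T (k + 1) + T (k ∸ 1) ∸ 3 →
    IsNsc t n m → m ≤ T k
mainTheorem11 zero    n m () _ _ _
mainTheorem11 (suc j) n m _  _ bound (distinct , _) =
  nsc≤period t n m (T (suc j)) (≤-trans (s≤s z≤n) (n<T (suc j)))
    (λ l l<n → periodic (suc j) l (<-≤-trans l<n (n≤L j n bound)))
    distinct
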